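{- Let $t\ge 3$ and let $\mathcal{H}$ be an $n$-vertex $3$-uniform hypergraph that does not contain $K_{2,t}$ as a trace. Let $A$ be the set of edges of $\mathcal{H}$ containing at least one pair $\{x,y\}$ with $d_{\mathcal{H}}(x,y)=1$, and let $B=\mathcal{H}\setminus A$. Fix a vertex $v$. Let $N_1(v)$ be the set of vertices $x$ such that some edge of $B$ contains $\{v,x\}$, and $N_2(v)$ the set of vertices $x\notin N_1(v)\cup\{v\}$ such that $x\in e$ for some edge $e\in B$ with $e\cap N_1(v)\neq\emptyset$. For $u\in N_1(v)$ let $E_u=\{e\in B: e\cap N_1(v)=\{u\}\}$ and $V_u=\{w\in N_2(v): w\in e \text{ for some } e\in E_u\}$. Then for any edge $\{v,u,w\}\in B$, $|V_u\cap V_w|\le (t-1)(6t-2)$.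
   Context: A hypergraph $\mathcal{H}$ contains a graph $F$ (vertices $v_1,\ldots,v_p$, edges $e_1,\ldots,e_q$) as a trace if there exist distinct vertices $w_1,\ldots,w_p\in V(\mathcal{H})$ and distinct edges $f_1,\ldots,f_q\in E(\mathcal{H})$ such that whenever $e_i=v_\alpha v_\beta$ we have $f_i\cap\{w_1,\ldots,w_p\}=\{w_\alpha,w_\beta\}$. The co-degree $d_{\mathcal{H}}(x,y)$ is the number of edges of $\mathcal{H}$ containing $\{x,y\}$. $\mathcal{H}\setminus A$ denotes the hypergraph on $V(\mathcal{H})$ with edge set $E(\mathcal{H})\setminus A$. -}

module Defs where

open import Data.Nat using (ℕ; _≡ᵇ_)
open import Data.Bool using (Bool; true; false; _∧_; not)
import Data.Bool as Bool
open import Data.Bool.ListAction using (any; all)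
open import Data.Fin using (Fin; _≟_)
open import Data.Fin.Subset using (Subset; ⁅_⁆; _∪_; ∣_∣)
import Data.Fin.Subset as S
open import Data.List using (List; length; filterᵇ; allFin)
open import Data.List.Membership.Propositional using (_∈_)
open import Data.List.Relation.Unary.All using (All)
open import Data.List.Relation.Unary.Unique.Propositional using (Unique)
open import Data.Vec using (lookup; tabulate)
open import Data.Product using (Σ; _×_)
open import Function.Bundles using (_⇔_)
open import Relation.Binary.PropositionalEquality using (_≡_; _≢_)
open import Relation.Nullary.Decidable using (⌊_⌋)

Hypergraph : ℕ → Set
Hypergraph n = List (Subset n)

Simple3Uniform : ∀ {n} → Hypergraph n → Set
Simple3Uniform H = Unique H × All (λ e → ∣ e ∣ ≡ 3) H

_=ᶠ_ : ∀ {n} → Fin n → Fin n → Bool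
x =ᶠ y = ⌊ x ≟ y ⌋

anyV : ∀ {n} → (Fin n → Bool) → Bool
anyV p = any p (allFin _)

allV : ∀ {n} → (Fin n → Bool) → Bool
allV p = all p (allFin _)

codeg : ∀ {n} → Hypergraph n → Fin n → Fin n → ℕ
codeg H x y = length (filterᵇ (λ e → lookup e x ∧ lookup e y) H)

hasCodeg1Pair : ∀ {n} → Hypergraph n → Subset n → Bool
hasCodeg1Pair H e =
  anyV (λ x → anyV (λ y →
    not (x =ᶠ y) ∧ lookup e x ∧ lookup e y ∧ (codeg H x y ≡ᵇ 1)))

Aset : ∀ {n} → Hypergraph n → Hypergraph n
Aset H = filterᵇ (hasCodeg1Pair H) H

Bset : ∀ {n} → Hypergraph n → Hypergraph n
Bset H = filterᵇ (λ e → not (hasCodeg1Pair H e)) H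

N₁ : ∀ {n} → Hypergraph n → Fin n → Subset n
N₁ H v = tabulate (λ x → not (x =ᶠ v) ∧ any (λ e → lookup e v ∧ lookup e x) (Bset H))

meetsN₁ : ∀ {n} → Hypergraph n → Fin n → Subset n → Bool
meetsN₁ H v e = anyV (λ y → lookup e y ∧ lookup (N₁ H v) y)

N₂ : ∀ {n} → Hypergraph n → Fin n → Subset n
N₂ H v = tabulate (λ x →
  not (lookup (N₁ H v) x) ∧ not (x =ᶠ v) ∧
  any (λ e → lookup e x ∧ meetsN₁ H v e) (Bset H))

-- e ∈ E_u  iff  e ∈ B and e ∩ N₁(v) = {u}  (membership in B checked by the caller)
inE : ∀ {n} → Hypergraph n → Fin n → Fin n → Subset n → Bool
inE H v u e = allV (λ y → ⌊ (lookup e y ∧ lookup (N₁ H v) y) Bool.≟ (y =ᶠ u) ⌋)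

Vset : ∀ {n} → Hypergraph n → Fin n → Fin n → Subset n
Vset H v u = tabulate (λ w →
  lookup (N₂ H v) w ∧ any (λ e → inE H v u e ∧ lookup e w) (Bset H))

-- H contains K_{2,t} as a trace: distinct vertices a₁,a₂ (class of size 2),
-- b₁..b_t (class of size t), and distinct edges f i j of H (one per graph
-- edge a_i b_j) with f i j ∩ {a's, b's} = {a_i, b_j}.
record K2tTrace {n : ℕ} (t : ℕ) (H : Hypergraph n) : Set where
  field
    a : Fin 2 → Fin n
    b : Fin t → Fin n
    a-inj : ∀ i i' → a i ≡ a i' → i ≡ i'
    b-inj : ∀ j j' → b j ≡ b j' → j ≡ j'
    a≢b : ∀ i j → a i ≢ b j
    f : Fin 2 → Fin t → Subset n
    f-edge : ∀ i j → f i j ∈ H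
    f-inj : ∀ i j i' j' → f i j ≡ f i' j' → (i ≡ i') × (j ≡ j')
    f-a : ∀ i j k → (a k S.∈ f i j) ⇔ (k ≡ i)
    f-b : ∀ i j l → (b l S.∈ f i j) ⇔ (l ≡ j)

{-# OPTIONS --safe #-}
-- For y ∈ V_u ∩ V_w choose edges e_u(y) ∈ E_u and e_w(y) ∈ E_w through y, its spokes.
-- An edge of E_c meets N₁(v) only in c, while u, w ∈ N₁(v) and y ∉ N₁(v); hence
-- e_u(y) = {u, y, y′} with w ∉ e_u(y), and symmetrically e_w(y) = {w, y, y″}.  Joining y to
-- y′ and y″ gives a digraph on V_u ∩ V_w of out-degree at most 2, so some vertex has
-- in-degree at most 2; deleting it together with its at most four neighbours and recursing
-- shows that 5t vertices contain t pairwise non-adjacent ones b_1, …, b_t.  The spokes of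
-- the b_j then form a trace of K_{2,t} on {u, w} ∪ {b_j}, so |V_u ∩ V_w| < 5t ≤ (t−1)(6t−2).

module Submission where

open import Defs
open import Data.Bool using (Bool; true; false; _∧_; not; T)
open import Data.Bool.ListAction using (any)
open import Data.Bool.Properties using (T-≡; T-∧; T-not-≡)
open import Data.Fin using (Fin; zero; suc; _≟_)
open import Data.Fin.Properties using (any?)
open import Data.Fin.Subset using (Subset; ⁅_⁆; _∪_; _∩_; ∁; _-_; ∣_∣; ⊥)
import Data.Fin.Subset as S
open import Data.Fin.Subset.Properties
  using ( _∈?_; x∈⁅x⁆; ∣⁅x⁆∣≡1; ∣p∣≤∣x∷p∣; ∣p∩q∣≤∣q∣; x∈p∪q⁺; x∈p∩q⁻; p∩q⊆p; p⊆p∪q; q⊆p∪q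
        ; x∈∁p⇒x∉p; ∪-assoc; ∪-idem; ∩-distribˡ-∪; x∈p⇒∣p-x∣<∣p∣; x∈p∧x≢y⇒x∈p-y)
open import Data.List using (_∷_; findᵇ; allFin)
open import Data.List.Membership.Propositional using (_∈_)
open import Data.List.Membership.Propositional.Properties using (∈-allFin; ∈-filter⁻)
open import Data.List.Relation.Unary.Any using (here; there)
import Data.List.Relation.Unary.All as All
open import Data.List.Relation.Unary.All.Properties using (all⁺)
open import Data.Maybe using (fromMaybe)
open import Data.Nat using (ℕ; zero; suc; _+_; _*_; _∸_; _≤_; _<_; z≤n; s≤s)
open import Data.Nat.Properties hiding (_≟_)
open import Algebra.Properties.Semiring.Sum +-*-semiring
  using (sum; sum-syntax; sum-cong-≗; ∑-distrib-+; ∑-comm; *-distribˡ-sum)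
open import Data.Product using (∃-syntax; _×_; _,_; proj₁; proj₂)
open import Data.Sum using (inj₁; inj₂)
open import Data.Unit using (tt)
open import Data.Vec using (_∷_; []; lookup; tabulate)
open import Data.Vec.Properties using (lookup-zipWith; lookup-map; lookup∘tabulate; []=⇒lookup; lookup⇒[]=)
open import Function using (_∘_)
open import Function.Bundles using (_⇔_; mk⇔; Equivalence)
open import Relation.Binary.PropositionalEquality
open import Relation.Nullary using (¬_; yes; no)
open import Relation.Nullary.Decidable using (_×-dec_; toWitness; fromWitness)
open import Relation.Nullary.Negation using (contradiction)

open Equivalence using (to; from)

private
  variable
    n : ℕ

∈⇔T : ∀ {x : Fin n} {p : Subset n} → x S.∈ p ⇔ T (lookup p x)
∈⇔T = mk⇔ (from T-≡ ∘ []=⇒lookup) (lookup⇒[]= _ _ ∘ to T-≡)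

∈tabulate⇔T : ∀ {x : Fin n} {f : Fin n → Bool} → x S.∈ tabulate f ⇔ T (f x)
∈tabulate⇔T {x = x} {f} = mk⇔ (λ x∈ → subst T (lookup∘tabulate f x) (to ∈⇔T x∈))
                              (λ fx → from ∈⇔T (subst T (sym (lookup∘tabulate f x)) fx))

indicator : Bool → ℕ
indicator true = 1
indicator false = 0

indicator-∧ : ∀ a b → indicator (a ∧ b) ≡ indicator a * indicator b
indicator-∧ true b = sym (+-identityʳ (indicator b))
indicator-∧ false b = refl

∑-mono-≤ : ∀ {f g : Fin n → ℕ} → (∀ i → f i ≤ g i) → sum f ≤ sum g
∑-mono-≤ {zero} f≤g = z≤n
∑-mono-≤ {suc n} f≤g = +-mono-≤ (f≤g zero) (∑-mono-≤ (λ i → f≤g (suc i)))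

∣p∣≡∑ : (p : Subset n) → ∣ p ∣ ≡ ∑[ i < n ] indicator (lookup p i)
∣p∣≡∑ [] = refl
∣p∣≡∑ (true ∷ p) = cong suc (∣p∣≡∑ p)
∣p∣≡∑ (false ∷ p) = ∣p∣≡∑ p

∣p∪q∣≤∣p∣+∣q∣ : (p q : Subset n) → ∣ p ∪ q ∣ ≤ ∣ p ∣ + ∣ q ∣
∣p∪q∣≤∣p∣+∣q∣ [] [] = z≤n
∣p∪q∣≤∣p∣+∣q∣ (true ∷ p) (y ∷ q) = s≤s (≤-trans (∣p∪q∣≤∣p∣+∣q∣ p q) (+-monoʳ-≤ ∣ p ∣ (∣p∣≤∣x∷p∣ y q)))
∣p∪q∣≤∣p∣+∣q∣ (false ∷ p) (true ∷ q) = ≤-trans (s≤s (∣p∪q∣≤∣p∣+∣q∣ p q)) (≤-reflexive (sym (+-suc ∣ p ∣ ∣ q ∣)))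
∣p∪q∣≤∣p∣+∣q∣ (false ∷ p) (false ∷ q) = ∣p∪q∣≤∣p∣+∣q∣ p q

∣p∣≡∣p∩∁q∣+∣p∩q∣ : (p q : Subset n) → ∣ p ∣ ≡ ∣ p ∩ ∁ q ∣ + ∣ p ∩ q ∣
∣p∣≡∣p∩∁q∣+∣p∩q∣ {n} p q = begin
  ∣ p ∣                                                       ≡⟨ ∣p∣≡∑ p ⟩
  ∑[ i < n ] indicator (lookup p i)                          ≡⟨ sum-cong-≗ {n} split ⟩
  ∑[ i < n ] (indicator (lookup (p ∩ ∁ q) i) + indicator (lookup (p ∩ q) i))
                                                              ≡⟨ ∑-distrib-+ {n} _ _ ⟩
  ∑[ i < n ] indicator (lookup (p ∩ ∁ q) i) + ∑[ i < n ] indicator (lookup (p ∩ q) i)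
                                                              ≡⟨ sym (cong₂ _+_ (∣p∣≡∑ (p ∩ ∁ q)) (∣p∣≡∑ (p ∩ q))) ⟩
  ∣ p ∩ ∁ q ∣ + ∣ p ∩ q ∣                                       ∎
  where
  open ≡-Reasoning
  split : ∀ i → indicator (lookup p i) ≡ indicator (lookup (p ∩ ∁ q) i) + indicator (lookup (p ∩ q) i)
  split i rewrite lookup-zipWith _∧_ i p q | lookup-zipWith _∧_ i p (∁ q) | lookup-map i not q
    with lookup p i | lookup q i
  ... | true  | true  = refl
  ... | true  | false = refl
  ... | false | true  = refl
  ... | false | false = refl

∣p-x-y∣+2≤∣p∣ : ∀ {p : Subset n} {x y} → x S.∈ p → y S.∈ p → y ≢ x → 2 + ∣ p - x - y ∣ ≤ ∣ p ∣
∣p-x-y∣+2≤∣p∣ x∈p y∈p y≢x = ≤-trans (s≤s (x∈p⇒∣p-x∣<∣p∣ (x∈p∧x≢y⇒x∈p-y y∈p y≢x))) (x∈p⇒∣p-x∣<∣p∣ x∈p)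

module Digraph {n : ℕ} (N : Fin n → Subset n) where

  In : Fin n → Subset n
  In x = tabulate (λ y → lookup (N y) x)

  ∈In⇔∈N : ∀ {x y} → y S.∈ In x ⇔ x S.∈ N y
  ∈In⇔∈N = mk⇔ (from ∈⇔T ∘ to ∈tabulate⇔T) (from ∈tabulate⇔T ∘ to ∈⇔T)

  OutDegree≤ : ℕ → Subset n → Set
  OutDegree≤ d M = ∀ {y} → y S.∈ M → ∣ N y ∣ ≤ d

  record Independent (k : ℕ) (M : Subset n) : Set where
    field
      vertex : Fin k → Fin n
      vertex-injective : ∀ {j l} → vertex j ≡ vertex l → j ≡ l
      vertex∈M : ∀ j → vertex j S.∈ M
      nonadjacent : ∀ {j l} → j ≢ l → vertex l S.∉ N (vertex j)

  ∑∣M∩In∣≤d*∣M∣ : ∀ {d M} → OutDegree≤ d M → ∑[ x < n ] ∣ M ∩ In x ∣ ≤ d * ∣ M ∣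
  ∑∣M∩In∣≤d*∣M∣ {d} {M} deg = begin
    ∑[ x < n ] ∣ M ∩ In x ∣                                       ≡⟨ sum-cong-≗ {n} (λ x → ∣p∣≡∑ (M ∩ In x)) ⟩
    ∑[ x < n ] ∑[ y < n ] indicator (lookup (M ∩ In x) y)        ≡⟨ sum-cong-≗ {n} (λ x → sum-cong-≗ {n} (entry x)) ⟩
    ∑[ x < n ] ∑[ y < n ] (m y * indicator (lookup (N y) x))     ≡⟨ ∑-comm {n} {n} _ ⟩
    ∑[ y < n ] ∑[ x < n ] (m y * indicator (lookup (N y) x))     ≡⟨ sum-cong-≗ {n} (λ y → sym (out y)) ⟩
    ∑[ y < n ] (m y * ∣ N y ∣)                                    ≤⟨ ∑-mono-≤ bound ⟩
    ∑[ y < n ] (d * m y)                                          ≡⟨ sym (*-distribˡ-sum d m) ⟩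
    d * ∑[ y < n ] m y                                            ≡⟨ cong (d *_) (sym (∣p∣≡∑ M)) ⟩
    d * ∣ M ∣                                                     ∎
    where
    open ≤-Reasoning
    m : Fin n → ℕ
    m y = indicator (lookup M y)
    entry : ∀ x y → indicator (lookup (M ∩ In x) y) ≡ m y * indicator (lookup (N y) x)
    entry x y rewrite lookup-zipWith _∧_ y M (In x) | lookup∘tabulate (λ z → lookup (N z) x) y =
      indicator-∧ (lookup M y) (lookup (N y) x)
    out : ∀ y → m y * ∣ N y ∣ ≡ ∑[ x < n ] (m y * indicator (lookup (N y) x))
    out y = trans (cong (m y *_) (∣p∣≡∑ (N y))) (*-distribˡ-sum {n} (m y) _)
    bound : ∀ y → m y * ∣ N y ∣ ≤ d * m y
    bound y with lookup M y in y∈M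
    ... | false = z≤n
    ... | true  = ≤-trans (≤-reflexive (+-identityʳ ∣ N y ∣))
                    (≤-trans (deg (lookup⇒[]= y M y∈M)) (≤-reflexive (sym (*-identityʳ d))))

  low-in-degree : ∀ {d M} → OutDegree≤ d M → 0 < ∣ M ∣ → ∃[ x ] x S.∈ M × ∣ M ∩ In x ∣ ≤ d
  low-in-degree {d} {M} deg 0<∣M∣ with any? (λ x → (x ∈? M) ×-dec (∣ M ∩ In x ∣ ≤? d))
  ... | yes found = found
  ... | no none = contradiction (+-cancelʳ-≤ (d * ∣ M ∣) ∣ M ∣ 0 too-many) (<⇒≱ 0<∣M∣)
    where
    open ≤-Reasoning
    high : ∀ x → suc d * indicator (lookup M x) ≤ ∣ M ∩ In x ∣
    high x with lookup M x in x∈M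
    ... | false = ≤-trans (≤-reflexive (*-zeroʳ (suc d))) z≤n
    ... | true with ∣ M ∩ In x ∣ ≤? d
    ...   | yes low = contradiction (x , lookup⇒[]= x M x∈M , low) none
    ...   | no ¬low = ≤-trans (≤-reflexive (*-identityʳ (suc d))) (≰⇒> ¬low)
    too-many : ∣ M ∣ + d * ∣ M ∣ ≤ 0 + d * ∣ M ∣
    too-many = begin
      suc d * ∣ M ∣                                ≡⟨ cong (suc d *_) (∣p∣≡∑ M) ⟩
      suc d * ∑[ x < n ] indicator (lookup M x)    ≡⟨ *-distribˡ-sum {n} (suc d) _ ⟩
      ∑[ x < n ] (suc d * indicator (lookup M x))  ≤⟨ ∑-mono-≤ high ⟩
      ∑[ x < n ] ∣ M ∩ In x ∣                      ≤⟨ ∑∣M∩In∣≤d*∣M∣ deg ⟩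
      d * ∣ M ∣                                    ∎

  ∉⁅x⁆∪N∪In : ∀ {x y} → y S.∉ ⁅ x ⁆ ∪ N x ∪ In x → y ≢ x × y S.∉ N x × x S.∉ N y
  ∉⁅x⁆∪N∪In {x} y∉ =
      (λ { refl → y∉ (x∈p∪q⁺ (inj₁ (x∈⁅x⁆ x))) })
    , (λ y∈Nx → y∉ (x∈p∪q⁺ (inj₂ (x∈p∪q⁺ (inj₁ y∈Nx)))))
    , (λ x∈Ny → y∉ (x∈p∪q⁺ (inj₂ (x∈p∪q⁺ (inj₂ (from ∈In⇔∈N x∈Ny))))))

  module _ {d : ℕ} where

    ∣M∩⁅x⁆∪N∪In∣≤ : ∀ {M x} → OutDegree≤ d M → x S.∈ M → ∣ M ∩ In x ∣ ≤ d →
                    ∣ M ∩ (⁅ x ⁆ ∪ N x ∪ In x) ∣ ≤ 1 + 2 * d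
    ∣M∩⁅x⁆∪N∪In∣≤ {M} {x} deg x∈M in≤d = begin
      ∣ M ∩ (⁅ x ⁆ ∪ N x ∪ In x) ∣                      ≡⟨ cong ∣_∣ (∩-distribˡ-∪ M ⁅ x ⁆ (N x ∪ In x)) ⟩
      ∣ M ∩ ⁅ x ⁆ ∪ M ∩ (N x ∪ In x) ∣                   ≤⟨ ∣p∪q∣≤∣p∣+∣q∣ (M ∩ ⁅ x ⁆) _ ⟩
      ∣ M ∩ ⁅ x ⁆ ∣ + ∣ M ∩ (N x ∪ In x) ∣               ≡⟨ cong (λ s → ∣ M ∩ ⁅ x ⁆ ∣ + ∣ s ∣) (∩-distribˡ-∪ M (N x) (In x)) ⟩
      ∣ M ∩ ⁅ x ⁆ ∣ + ∣ M ∩ N x ∪ M ∩ In x ∣             ≤⟨ +-monoʳ-≤ ∣ M ∩ ⁅ x ⁆ ∣ (∣p∪q∣≤∣p∣+∣q∣ (M ∩ N x) _) ⟩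
      ∣ M ∩ ⁅ x ⁆ ∣ + (∣ M ∩ N x ∣ + ∣ M ∩ In x ∣)       ≤⟨ +-mono-≤ (≤-trans (∣p∩q∣≤∣q∣ M ⁅ x ⁆) (≤-reflexive (∣⁅x⁆∣≡1 x)))
                                                           (+-mono-≤ (≤-trans (∣p∩q∣≤∣q∣ M (N x)) (deg x∈M)) in≤d) ⟩
      1 + (d + d)                                      ≡⟨ cong (λ s → 1 + (d + s)) (sym (+-identityʳ d)) ⟩
      1 + 2 * d                                        ∎
      where open ≤-Reasoning

    residual-large : ∀ {k M x} → OutDegree≤ d M → x S.∈ M → ∣ M ∩ In x ∣ ≤ d →
                     (1 + 2 * d) * suc k ≤ ∣ M ∣ → (1 + 2 * d) * k ≤ ∣ M ∩ ∁ (⁅ x ⁆ ∪ N x ∪ In x) ∣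
    residual-large {k} {M} {x} deg x∈M in≤d big = +-cancelˡ-≤ (1 + 2 * d) _ _ (begin
      (1 + 2 * d) + (1 + 2 * d) * k    ≡⟨ sym (*-suc (1 + 2 * d) k) ⟩
      (1 + 2 * d) * suc k              ≤⟨ big ⟩
      ∣ M ∣                            ≡⟨ ∣p∣≡∣p∩∁q∣+∣p∩q∣ M R ⟩
      ∣ M ∩ ∁ R ∣ + ∣ M ∩ R ∣           ≤⟨ +-monoʳ-≤ ∣ M ∩ ∁ R ∣ (∣M∩⁅x⁆∪N∪In∣≤ deg x∈M in≤d) ⟩
      ∣ M ∩ ∁ R ∣ + (1 + 2 * d)         ≡⟨ +-comm ∣ M ∩ ∁ R ∣ _ ⟩
      (1 + 2 * d) + ∣ M ∩ ∁ R ∣         ∎)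
      where
      open ≤-Reasoning
      R : Subset n
      R = ⁅ x ⁆ ∪ N x ∪ In x

    independent : ∀ k {M} → OutDegree≤ d M → (1 + 2 * d) * k ≤ ∣ M ∣ → Independent k M
    independent zero _ _ = record
      { vertex = λ () ; vertex-injective = λ {j} → contradiction j λ ()
      ; vertex∈M = λ () ; nonadjacent = λ {j} → contradiction j λ () }
    independent (suc k) {M} deg big with low-in-degree deg (≤-trans (m≤m+n 1 _) (≤-trans (≤-reflexive (sym (*-suc (1 + 2 * d) k))) big))
    ... | x , x∈M , in≤d = record
      { vertex = vertex ; vertex-injective = injective ; vertex∈M = ∈M ; nonadjacent = nonadjacent }
      where
      R : Subset n
      R = ⁅ x ⁆ ∪ N x ∪ In x
      open Independent (independent k (deg ∘ p∩q⊆p M (∁ R)) (residual-large deg x∈M in≤d big))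
        renaming (vertex to vertex′; vertex-injective to injective′; vertex∈M to ∈M∩∁R; nonadjacent to nonadjacent′)
      apart : ∀ j → vertex′ j ≢ x × vertex′ j S.∉ N x × x S.∉ N (vertex′ j)
      apart j = ∉⁅x⁆∪N∪In (x∈∁p⇒x∉p (proj₂ (x∈p∩q⁻ M (∁ R) (∈M∩∁R j))))
      vertex : Fin (suc k) → Fin n
      vertex zero = x
      vertex (suc j) = vertex′ j
      injective : ∀ {j l} → vertex j ≡ vertex l → j ≡ l
      injective {zero} {zero} _ = refl
      injective {zero} {suc l} eq = contradiction (sym eq) (proj₁ (apart l))
      injective {suc j} {zero} eq = contradiction eq (proj₁ (apart j))
      injective {suc j} {suc l} eq = cong suc (injective′ eq)
      ∈M : ∀ j → vertex j S.∈ M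
      ∈M zero = x∈M
      ∈M (suc j) = p∩q⊆p M (∁ R) (∈M∩∁R j)
      nonadjacent : ∀ {j l} → j ≢ l → vertex l S.∉ N (vertex j)
      nonadjacent {zero} {zero} j≢l = contradiction refl j≢l
      nonadjacent {zero} {suc l} _ = proj₁ (proj₂ (apart l))
      nonadjacent {suc j} {zero} _ = proj₂ (proj₂ (apart j))
      nonadjacent {suc j} {suc l} j≢l = nonadjacent′ (j≢l ∘ cong suc)

separated⇒injective : ∀ {I J : Set} {a : I → Fin n} {b : J → Fin n} {f : I → J → Subset n} →
  (∀ i j k → a k S.∈ f i j ⇔ k ≡ i) → (∀ i j l → b l S.∈ f i j ⇔ l ≡ j) →
  ∀ i j i′ j′ → f i j ≡ f i′ j′ → i ≡ i′ × j ≡ j′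
separated⇒injective f-a f-b i j i′ j′ eq =
    sym (to (f-a i j i′) (subst (_ S.∈_) (sym eq) (from (f-a i′ j′ i′) refl)))
  , sym (to (f-b i j j′) (subst (_ S.∈_) (sym eq) (from (f-b i′ j′ j′) refl)))

fromMaybe-findᵇ : ∀ {A : Set} (d : A) (p : A → Bool) xs → T (any p xs) →
  let x = fromMaybe d (findᵇ p xs) in x ∈ xs × T (p x)
fromMaybe-findᵇ d p (x ∷ xs) found with p x in px
... | true = here refl , subst T (sym px) tt
... | false = let x∈xs , px = fromMaybe-findᵇ d p xs found in there x∈xs , px

∣⁅x⁆∪⁅y⁆∪⁅z⁆∣≡3⇒y≢z : ∀ {x y z : Fin n} → ∣ (⁅ x ⁆ ∪ ⁅ y ⁆) ∪ ⁅ z ⁆ ∣ ≡ 3 → y ≢ z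
∣⁅x⁆∪⁅y⁆∪⁅z⁆∣≡3⇒y≢z {x = x} {y} size refl = 1+n≰n (begin
  3                             ≡⟨ sym size ⟩
  ∣ (⁅ x ⁆ ∪ ⁅ y ⁆) ∪ ⁅ y ⁆ ∣     ≡⟨ cong ∣_∣ (trans (∪-assoc ⁅ x ⁆ ⁅ y ⁆ ⁅ y ⁆) (cong (⁅ x ⁆ ∪_) (∪-idem ⁅ y ⁆))) ⟩
  ∣ ⁅ x ⁆ ∪ ⁅ y ⁆ ∣               ≤⟨ ∣p∪q∣≤∣p∣+∣q∣ ⁅ x ⁆ ⁅ y ⁆ ⟩
  ∣ ⁅ x ⁆ ∣ + ∣ ⁅ y ⁆ ∣            ≡⟨ cong₂ _+_ (∣⁅x⁆∣≡1 x) (∣⁅x⁆∣≡1 y) ⟩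
  2                             ∎)
  where open ≤-Reasoning

Bset⊆H : (H : Hypergraph n) → ∀ {e} → e ∈ Bset H → e ∈ H
Bset⊆H H = proj₁ ∘ ∈-filter⁻ _

edge-size : ∀ {H : Hypergraph n} → Simple3Uniform H → ∀ {e} → e ∈ H → ∣ e ∣ ≡ 3
edge-size (_ , uniform) = All.lookup uniform

module _ (H : Hypergraph n) (v : Fin n) where

  record IsEdgeOfE (c : Fin n) (e : Subset n) : Set where
    field
      ∈B : e ∈ Bset H
      c∈e : c S.∈ e
      c∈N₁ : c S.∈ N₁ H v
      N₁∩e⊆⁅c⁆ : ∀ {z} → z S.∈ N₁ H v → z S.∈ e → z ≡ c

  inE⇒IsEdgeOfE : ∀ {c e} → e ∈ Bset H → T (inE H v c e) → IsEdgeOfE c e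
  inE⇒IsEdgeOfE {c} {e} e∈B e∈E = record
    { ∈B = e∈B
    ; c∈e = from ∈⇔T (proj₁ at-c)
    ; c∈N₁ = from ∈⇔T (proj₂ at-c)
    ; N₁∩e⊆⁅c⁆ = λ z∈N₁ z∈e → toWitness (subst T (meets _) (from T-∧ (to ∈⇔T z∈e , to ∈⇔T z∈N₁)))
    }
    where
    meets : ∀ z → (lookup e z ∧ lookup (N₁ H v) z) ≡ (z =ᶠ c)
    meets z = toWitness (All.lookup (all⁺ _ (allFin _) e∈E) (∈-allFin z))
    at-c : T (lookup e c) × T (lookup (N₁ H v) c)
    at-c = to T-∧ (subst T (sym (meets c)) (fromWitness {a? = c ≟ c} refl))

  -- ⊥ is a junk value: edgeThrough c y is only used when y ∈ V_c.
  edgeThrough : Fin n → Fin n → Subset n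
  edgeThrough c y = fromMaybe ⊥ (findᵇ (λ e → inE H v c e ∧ lookup e y) (Bset H))

  module _ {c y : Fin n} (y∈V : y S.∈ Vset H v c) where

    private
      y∈N₂×through : T (lookup (N₂ H v) y) × T (any (λ e → inE H v c e ∧ lookup e y) (Bset H))
      y∈N₂×through = to T-∧ (to ∈tabulate⇔T y∈V)

    ∈Vset⇒∉N₁ : y S.∉ N₁ H v
    ∈Vset⇒∉N₁ y∈N₁ = contradiction (trans (sym (to T-≡ (to ∈⇔T y∈N₁))) (to T-not-≡ y∉N₁)) λ ()
      where
      y∉N₁ : T (not (lookup (N₁ H v) y))
      y∉N₁ = proj₁ (to T-∧ (to ∈tabulate⇔T (from (∈⇔T {p = N₂ H v}) (proj₁ y∈N₂×through))))

    private
      chosen : edgeThrough c y ∈ Bset H × T (inE H v c (edgeThrough c y) ∧ lookup (edgeThrough c y) y)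
      chosen = fromMaybe-findᵇ ⊥ (λ e → inE H v c e ∧ lookup e y) (Bset H) (proj₂ y∈N₂×through)

    edgeThrough-IsEdgeOfE : IsEdgeOfE c (edgeThrough c y)
    edgeThrough-IsEdgeOfE = inE⇒IsEdgeOfE (proj₁ chosen) (proj₁ (to T-∧ (proj₂ chosen)))

    y∈edgeThrough : y S.∈ edgeThrough c y
    y∈edgeThrough = from ∈⇔T (proj₂ (to T-∧ (proj₂ chosen)))

module Spokes (H : Hypergraph n) (uniform : Simple3Uniform H) (v u w : Fin n) (u≢w : u ≢ w) where

  pole : Fin 2 → Fin n
  pole zero = u
  pole (suc zero) = w

  pole-injective : ∀ {i k} → pole i ≡ pole k → i ≡ k
  pole-injective {zero} {zero} _ = refl
  pole-injective {zero} {suc zero} eq = contradiction eq u≢w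
  pole-injective {suc zero} {zero} eq = contradiction (sym eq) u≢w
  pole-injective {suc zero} {suc zero} _ = refl

  V : Subset n
  V = Vset H v u ∩ Vset H v w

  ∈V⇒∈Vset : ∀ {y} → y S.∈ V → ∀ i → y S.∈ Vset H v (pole i)
  ∈V⇒∈Vset y∈V zero = proj₁ (x∈p∩q⁻ _ _ y∈V)
  ∈V⇒∈Vset y∈V (suc zero) = proj₂ (x∈p∩q⁻ _ _ y∈V)

  spoke : Fin 2 → Fin n → Subset n
  spoke i y = edgeThrough H v (pole i) y

  thirdVertices : Fin n → Subset n
  thirdVertices y = (spoke zero y - y - u) ∪ (spoke (suc zero) y - y - w)

  spoke-third⊆thirdVertices : ∀ i y → spoke i y - y - pole i S.⊆ thirdVertices y
  spoke-third⊆thirdVertices zero y = p⊆p∪q _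
  spoke-third⊆thirdVertices (suc zero) y = q⊆p∪q _ _

  module _ {y : Fin n} (y∈V : y S.∈ V) (i : Fin 2) where

    spoke-IsEdgeOfE : IsEdgeOfE H v (pole i) (spoke i y)
    spoke-IsEdgeOfE = edgeThrough-IsEdgeOfE H v (∈V⇒∈Vset y∈V i)

    open IsEdgeOfE spoke-IsEdgeOfE

    y∈spoke : y S.∈ spoke i y
    y∈spoke = y∈edgeThrough H v (∈V⇒∈Vset y∈V i)

    y∉N₁ : y S.∉ N₁ H v
    y∉N₁ = ∈Vset⇒∉N₁ H v (∈V⇒∈Vset y∈V i)

    pole∈N₁ : pole i S.∈ N₁ H v
    pole∈N₁ = c∈N₁

    pole≢y : pole i ≢ y
    pole≢y refl = y∉N₁ pole∈N₁

    ∣third∣≤1 : ∣ spoke i y - y - pole i ∣ ≤ 1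
    ∣third∣≤1 = ≤-pred (≤-pred (≤-trans (∣p-x-y∣+2≤∣p∣ y∈spoke c∈e pole≢y)
                                          (≤-reflexive (edge-size uniform (Bset⊆H H ∈B)))))

  out-degree≤2 : Digraph.OutDegree≤ thirdVertices 2 V
  out-degree≤2 {y} y∈V = ≤-trans (∣p∪q∣≤∣p∣+∣q∣ (spoke zero y - y - u) _)
                                 (+-mono-≤ (∣third∣≤1 y∈V zero) (∣third∣≤1 y∈V (suc zero)))

  independent⇒trace : ∀ {t} → Digraph.Independent thirdVertices t V → K2tTrace t H
  independent⇒trace {t} I = record
    { a = pole ; b = vertex ; a-inj = λ _ _ → pole-injective ; b-inj = λ _ _ → vertex-injective
    ; a≢b = λ i j eq → y∉N₁ (vertex∈M j) i (subst (S._∈ N₁ H v) eq (pole∈N₁ (vertex∈M j) i))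
    ; f = f ; f-edge = λ i j → Bset⊆H H (IsEdgeOfE.∈B (spoke-IsEdgeOfE (vertex∈M j) i))
    ; f-inj = separated⇒injective f-a f-b ; f-a = f-a ; f-b = f-b }
    where
    open Digraph.Independent I
    f : Fin 2 → Fin t → Subset n
    f i j = spoke i (vertex j)
    f-a : ∀ i j k → pole k S.∈ f i j ⇔ k ≡ i
    f-a i j k = mk⇔ (λ k∈ → pole-injective (N₁∩e⊆⁅c⁆ (pole∈N₁ (vertex∈M j) k) k∈)) (λ { refl → c∈e })
      where open IsEdgeOfE (spoke-IsEdgeOfE (vertex∈M j) i)
    f-b : ∀ i j l → vertex l S.∈ f i j ⇔ l ≡ j
    f-b i j l = mk⇔ to′ (λ { refl → y∈spoke (vertex∈M j) i })
      where
      to′ : vertex l S.∈ f i j → l ≡ j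
      to′ l∈ with l ≟ j
      ... | yes l≡j = l≡j
      ... | no l≢j = contradiction
        (spoke-third⊆thirdVertices i (vertex j)
          (x∈p∧x≢y⇒x∈p-y (x∈p∧x≢y⇒x∈p-y l∈ (l≢j ∘ vertex-injective))
                          (λ eq → pole≢y (vertex∈M l) i (sym eq))))
        (nonadjacent (l≢j ∘ sym))

5t≤[t∸1]*[6t∸2] : ∀ {t} → 3 ≤ t → 5 * t ≤ (t ∸ 1) * (6 * t ∸ 2)
5t≤[t∸1]*[6t∸2] {t@(suc (suc (suc _)))} 3≤t@(s≤s (s≤s (s≤s _))) = begin
  5 * t                 ≤⟨ m+n≤o⇒m≤o∸n (5 * t) 5t+2≤6t ⟩
  6 * t ∸ 2             ≤⟨ m≤n*m (6 * t ∸ 2) (t ∸ 1) ⟩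
  (t ∸ 1) * (6 * t ∸ 2) ∎
  where
  open ≤-Reasoning
  5t+2≤6t : 5 * t + 2 ≤ 6 * t
  5t+2≤6t = begin
    5 * t + 2        ≤⟨ +-monoʳ-≤ (5 * t) (m≤n⇒m≤1+n (≤-pred 3≤t)) ⟩
    5 * t + t        ≡⟨ cong (5 * t +_) (sym (*-identityˡ t)) ⟩
    5 * t + 1 * t    ≡⟨ sym (*-distribʳ-+ t 5 1) ⟩
    6 * t            ∎

mainTheorem5 : (t n : ℕ) → 3 ≤ t → (H : Hypergraph n) → Simple3Uniform H →
    ¬ K2tTrace t H → (v u w : Fin n) → ((⁅ v ⁆ ∪ ⁅ u ⁆) ∪ ⁅ w ⁆) ∈ Bset H →
    ∣ Vset H v u ∩ Vset H v w ∣ ≤ (t ∸ 1) * (6 * t ∸ 2)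
mainTheorem5 t n 3≤t H uniform no-trace v u w vuw∈B =
  ≤-trans (<⇒≤ (≰⇒> 5t≰∣V∣)) (5t≤[t∸1]*[6t∸2] 3≤t)
  where
  u≢w : u ≢ w
  u≢w = ∣⁅x⁆∪⁅y⁆∪⁅z⁆∣≡3⇒y≢z {x = v} (edge-size uniform (Bset⊆H H vuw∈B))
  open Spokes H uniform v u w u≢w
  5t≰∣V∣ : ¬ 5 * t ≤ ∣ V ∣
  5t≰∣V∣ 5t≤∣V∣ = no-trace (independent⇒trace (Digraph.independent thirdVertices t out-degree≤2 5t≤∣V∣))
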